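{- For integers $t,n\ge 1$, if $n\ge 3(2t^2-t-1)$, then every $1$-flip of $P_n$ has a pivot-minor isomorphic to $P_t$.
   Context: Graphs are finite and simple; $P_n$ is the path on $n$ vertices. Local complementation: $G\ast x:=(V(G),E(G)\triangle\{yz:y,z\in N_G(x),y\neq z\})$; pivoting an edge $uv$: $G\wedge uv:=G\ast u\ast v\ast u$; a pivot-minor is obtained by a (possibly empty) sequence of vertex deletions and pivotings. A $1$-flip of a graph $H$ is a graph $H\oplus(\mathcal{P},F)$ where $\mathcal{P}$ is a collection of at most one non-empty subset of $V(H)$ and $F\subseteq\mathcal{P}^2$; concretely, a $1$-flip of $H$ is either $H$ itself or the $X$-flip of $H$ for some non-empty $X\subseteq V(H)$, where the $X$-flip of $H$ is the graph on $V(H)$ in which distinct $u,v$ are adjacent iff either ($u,v\in X$ and $uv\notin E(H)$) or (not both of $u,v$ lie in $X$ and $uv\in E(H)$), i.e. the edge relation inside $X$ is complemented. -}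

module Defs where

open import Data.Nat using (ℕ; zero; suc; _+_)
open import Data.Fin using (Fin; toℕ; punchIn)
open import Data.Fin.Properties using (_≟_)
open import Data.Bool using (Bool; true; false; _∧_; _∨_; not; _xor_; if_then_else_)
open import Data.Product using (Σ; _×_)
open import Relation.Nullary using (does)
open import Relation.Binary.PropositionalEquality using (_≡_)
open import Function.Bundles using (_⤖_; Bijection)

-- All graphs arising below (from P_n by flips, local complementations and
-- deletions) are symmetric and loopless, i.e. finite simple graphs.
Graph : ℕ → Set
Graph n = Fin n → Fin n → Bool

_==_ : ∀ {n} → Fin n → Fin n → Bool
x == y = does (x ≟ y)

ℕ-eq : ℕ → ℕ → Bool
ℕ-eq zero zero = true
ℕ-eq zero (suc _) = false
ℕ-eq (suc _) zero = false
ℕ-eq (suc m) (suc k) = ℕ-eq m k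

Path : (n : ℕ) → Graph n
Path n i j = ℕ-eq (suc (toℕ i)) (toℕ j) ∨ ℕ-eq (suc (toℕ j)) (toℕ i)

_⋆_ : ∀ {n} → Graph n → Fin n → Graph n
(G ⋆ x) y z = if y == z then G y z else (G y z xor (G x y ∧ G x z))

-- pivoting: G ∧ uv = G ⋆ u ⋆ v ⋆ u (used only for edges uv)
pivot : ∀ {n} → Graph n → Fin n → Fin n → Graph n
pivot G u v = ((G ⋆ u) ⋆ v) ⋆ u

delete : ∀ {n} → Graph (suc n) → Fin (suc n) → Graph n
delete G v x y = G (punchIn v x) (punchIn v y)

data PivotMinor : ∀ {n m} → Graph n → Graph m → Set where
  pm-refl  : ∀ {n} (G : Graph n) → PivotMinor G G
  pm-del   : ∀ {n m} {G : Graph (suc n)} {H : Graph m} (v : Fin (suc n)) →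
             PivotMinor (delete G v) H → PivotMinor G H
  pm-pivot : ∀ {n m} {G : Graph n} {H : Graph m} (u v : Fin n) →
             G u v ≡ true → PivotMinor (pivot G u v) H → PivotMinor G H

_≅_ : ∀ {n m} → Graph n → Graph m → Set
_≅_ {n} {m} G H = Σ (Fin n ⤖ Fin m) λ f →
  ∀ x y → G x y ≡ H (Bijection.to f x) (Bijection.to f y)

flip : ∀ {n} → Graph n → (Fin n → Bool) → Graph n
flip G X u v = if (X u ∧ X v) ∧ not (u == v) then not (G u v) else G u v

data OneFlip {n : ℕ} (H : Graph n) : Graph n → Set where
  flip-none : OneFlip H H
  flip-one  : (X : Fin n → Bool) → Σ (Fin n) (λ x → X x ≡ true) →
              OneFlip H (flip H X)

-- Pivoting an edge between two
-- flipped vertices p and q ≥ p + 2 of a flipped path and deleting them leaves a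
-- flipped path: the path closes up over p and q, and only the flip status of
-- their neighbours changes; in particular p - 1 changes status while all
-- earlier vertices keep theirs.  Sweep from the left: a flipped vertex k is
-- cancelled against the next flipped vertex k + m + 1 by m + 1 such pivots,
-- each with a partner among the following t positions (if none of those is
-- flipped, they already induce P_t).  Clearing a position costs at most 2t
-- vertices, so 2t(t + 1) ≤ 3(2t² - t - 1) vertices suffice to make the first t
-- positions carry at most one flipped vertex.  Such a window induces P_t, and
-- induced subgraphs are pivot-minors.
module Submission where

open import Defs
open import Data.Nat using (ℕ; zero; suc; _+_; _*_; _∸_; _≤_; _<_; _<?_; z≤n; s≤s; s≤s⁻¹; s<s⁻¹)
open import Data.Nat.Properties
open import Data.Nat.DivMod using (_mod_; m<n⇒m%n≡m)
open import Data.Nat.Tactic.RingSolver using () renaming (solve-∀ to solve-ℕ)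
open import Data.Fin using (Fin; toℕ; punchOut)
open import Data.Fin.Properties
  using (toℕ-fromℕ<; toℕ-injective; toℕ<n; punchOut-injective; punchIn-punchOut; all?; any?; ¬∀⟶∃¬)
  renaming (_≟_ to _≟ᶠ_)
open import Data.Bool using (Bool; true; false; _∧_; _∨_; not; _xor_)
open import Data.Bool.Properties
  using (xor-∧-commutativeRing; ∨-comm; ∧-zeroʳ; xor-identityʳ; xor-comm; true-xor)
open import Data.Maybe using (just; nothing)
open import Data.Product using (Σ; ∃; _×_; _,_; proj₁; proj₂)
open import Data.Sum using (_⊎_; inj₁; inj₂)
open import Function.Base using (_∘_)
open import Function.Bundles using (mk⤖)
open import Function.Definitions using (Injective)
open import Relation.Binary.PropositionalEquality
open import Relation.Binary.Definitions using (tri<; tri≈; tri>)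
open import Relation.Nullary using (yes; no; contradiction)
open import Tactic.RingSolver using (solve-∀)
import Tactic.RingSolver.Core.AlmostCommutativeRing as ACR

private variable
  n m L : ℕ

GF₂ : ACR.AlmostCommutativeRing _ _
GF₂ = ACR.fromCommutativeRing xor-∧-commutativeRing λ { false → just refl ; true → nothing }

xor-true : ∀ x → x xor true ≡ not x
xor-true x = trans (xor-comm x true) (true-xor x)

-- Adjacency in the path on ℕ

ℕ-eq-refl : ∀ a → ℕ-eq a a ≡ true
ℕ-eq-refl zero    = refl
ℕ-eq-refl (suc a) = ℕ-eq-refl a

ℕ-eq-≢ : ∀ {a b} → a ≢ b → ℕ-eq a b ≡ false
ℕ-eq-≢ {zero}  {zero}  a≢b = contradiction refl a≢b
ℕ-eq-≢ {zero}  {suc b} _   = refl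
ℕ-eq-≢ {suc a} {zero}  _   = refl
ℕ-eq-≢ {suc a} {suc b} a≢b = ℕ-eq-≢ (a≢b ∘ cong suc)

adjℕ : ℕ → ℕ → Bool
adjℕ a b = ℕ-eq (suc a) b ∨ ℕ-eq (suc b) a

adjℕ-sym : ∀ a b → adjℕ a b ≡ adjℕ b a
adjℕ-sym a b = ∨-comm (ℕ-eq (suc a) b) _

adjℕ-irrefl : ∀ a → adjℕ a a ≡ false
adjℕ-irrefl a rewrite ℕ-eq-≢ (1+n≢n {a}) = refl

adjℕ-suc : ∀ a → adjℕ a (suc a) ≡ true
adjℕ-suc a rewrite ℕ-eq-refl a = refl

adjℕ-far : ∀ {a b} → 2 + a ≤ b → adjℕ a b ≡ false
adjℕ-far {a} {b} 2+a≤b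
  rewrite ℕ-eq-≢ (<⇒≢ 2+a≤b)
        | ℕ-eq-≢ {suc b} {a} (λ b+1≡a → <-asym (≤-trans (n≤1+n _) 2+a≤b) (≤-reflexive b+1≡a))
  = refl

adjℕ-far-sym : ∀ {a b} → 2 + a ≤ b → adjℕ b a ≡ false
adjℕ-far-sym {a} {b} 2+a≤b = trans (adjℕ-sym b a) (adjℕ-far 2+a≤b)

adjℕ-+ : ∀ w a b → adjℕ (w + a) (w + b) ≡ adjℕ a b
adjℕ-+ zero    a b = refl
adjℕ-+ (suc w) a b = adjℕ-+ w a b

punchInℕ : ℕ → ℕ → ℕ
punchInℕ zero    a       = suc a
punchInℕ (suc r) zero    = zero
punchInℕ (suc r) (suc a) = suc (punchInℕ r a)

punchInℕ-≢ : ∀ r a → punchInℕ r a ≢ r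
punchInℕ-≢ (suc r) (suc a) eq = punchInℕ-≢ r a (suc-injective eq)

punchInℕ-injective : ∀ r {a b} → punchInℕ r a ≡ punchInℕ r b → a ≡ b
punchInℕ-injective zero    eq = suc-injective eq
punchInℕ-injective (suc r) {zero}  {zero}  eq = refl
punchInℕ-injective (suc r) {suc a} {suc b} eq = cong suc (punchInℕ-injective r (suc-injective eq))

punchInℕ-< : ∀ {r a} → a < r → punchInℕ r a ≡ a
punchInℕ-< {suc r} {zero}  _         = refl
punchInℕ-< {suc r} {suc a} (s≤s a<r) = cong suc (punchInℕ-< a<r)

punchInℕ-≥ : ∀ {r a} → r ≤ a → punchInℕ r a ≡ suc a
punchInℕ-≥ {zero}  {a}     _         = refl
punchInℕ-≥ {suc r} {suc a} (s≤s r≤a) = cong suc (punchInℕ-≥ r≤a)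

punchInℕ-≤ : ∀ r a → punchInℕ r a ≤ suc a
punchInℕ-≤ zero    a       = ≤-refl
punchInℕ-≤ (suc r) zero    = z≤n
punchInℕ-≤ (suc r) (suc a) = s≤s (punchInℕ-≤ r a)

-- Local complementation at r, followed by deleting r, turns a path into a path.
adjℕ-punchIn : ∀ r {a b} → a ≢ b →
  adjℕ a b ≡ adjℕ (punchInℕ r a) (punchInℕ r b) xor (adjℕ r (punchInℕ r a) ∧ adjℕ r (punchInℕ r b))
adjℕ-punchIn zero {zero}  {zero}  a≢b = contradiction refl a≢b
adjℕ-punchIn zero {zero}  {suc b} _   = sym (xor-identityʳ _)
adjℕ-punchIn zero {suc a} {b}     _   = sym (xor-identityʳ _)
adjℕ-punchIn (suc r)             {zero}        {zero}        a≢b = contradiction refl a≢b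
adjℕ-punchIn (suc zero)          {zero}        {suc b}       _   = refl
adjℕ-punchIn (suc (suc r))       {zero}        {suc zero}    _   = refl
adjℕ-punchIn (suc (suc r))       {zero}        {suc (suc b)} _   = refl
adjℕ-punchIn (suc zero)          {suc zero}    {zero}        _   = refl
adjℕ-punchIn (suc zero)          {suc (suc a)} {zero}        _   = refl
adjℕ-punchIn (suc (suc zero))    {suc zero}    {zero}        _   = refl
adjℕ-punchIn (suc (suc (suc r))) {suc zero}    {zero}        _   = refl
adjℕ-punchIn (suc (suc r))       {suc (suc a)} {zero}        _   = sym (∧-zeroʳ _)
adjℕ-punchIn (suc r)             {suc a}       {suc b}       a≢b = adjℕ-punchIn r (a≢b ∘ cong suc)

punchIn₂ : ℕ → ℕ → ℕ → ℕ
punchIn₂ p q a = punchInℕ q (punchInℕ p a)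

module _ {p q : ℕ} (p+2≤q : 2 + p ≤ q) where

  private
    p<q : p < q
    p<q = ≤-trans (n≤1+n _) p+2≤q

  punchIn₂-≢ˡ : ∀ a → punchIn₂ p q a ≢ p
  punchIn₂-≢ˡ a with punchInℕ p a <? q
  ... | yes x<q = punchInℕ-≢ p a ∘ trans (sym (punchInℕ-< x<q))
  ... | no  x≮q = λ eq → <-asym p<q (subst (q <_) (trans (sym (punchInℕ-≥ q≤x)) eq) (s≤s q≤x))
    where q≤x = ≮⇒≥ x≮q

  punchIn₂-≢ʳ : ∀ a → punchIn₂ p q a ≢ q
  punchIn₂-≢ʳ a = punchInℕ-≢ q _

  punchIn₂-injective : ∀ {a b} → punchIn₂ p q a ≡ punchIn₂ p q b → a ≡ b
  punchIn₂-injective = punchInℕ-injective p ∘ punchInℕ-injective q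

  punchIn₂-< : ∀ {a} → a < p → punchIn₂ p q a ≡ a
  punchIn₂-< {a} a<p = trans (cong (punchInℕ q) (punchInℕ-< a<p)) (punchInℕ-< (<-trans a<p p<q))

  punchIn₂-bound : ∀ {a} → a < L → punchIn₂ p q a < 2 + L
  punchIn₂-bound {a = a} a<L = s≤s (≤-trans (punchInℕ-≤ q _) (s≤s (≤-trans (punchInℕ-≤ p a) a<L)))

  adjℕ-punchIn-far : ∀ x → adjℕ p (punchInℕ q x) ≡ adjℕ p x
  adjℕ-punchIn-far x with x <? q
  ... | yes x<q = cong (adjℕ p) (punchInℕ-< x<q)
  ... | no  x≮q = trans (cong (adjℕ p) (punchInℕ-≥ q≤x))
                        (trans (adjℕ-far (≤-trans p+2≤q (m≤n⇒m≤1+n q≤x))) (sym (adjℕ-far (≤-trans p+2≤q q≤x))))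
    where q≤x = ≮⇒≥ x≮q

  adjℕ-punchIn₂ : ∀ {a b} → a ≢ b →
    let A = punchIn₂ p q a ; B = punchIn₂ p q b in
    adjℕ a b ≡ (adjℕ A B xor (adjℕ q A ∧ adjℕ q B)) xor (adjℕ p A ∧ adjℕ p B)
  adjℕ-punchIn₂ {a} {b} a≢b = begin
    adjℕ a b
      ≡⟨ adjℕ-punchIn p a≢b ⟩
    adjℕ a′ b′ xor (adjℕ p a′ ∧ adjℕ p b′)
      ≡⟨ cong₂ _xor_ (adjℕ-punchIn q (a≢b ∘ punchInℕ-injective p))
                     (sym (cong₂ _∧_ (adjℕ-punchIn-far a′) (adjℕ-punchIn-far b′))) ⟩
    (adjℕ (punchInℕ q a′) (punchInℕ q b′) xor (adjℕ q (punchInℕ q a′) ∧ adjℕ q (punchInℕ q b′)))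
      xor (adjℕ p (punchInℕ q a′) ∧ adjℕ p (punchInℕ q b′)) ∎
    where
    open ≡-Reasoning
    a′ = punchInℕ p a
    b′ = punchInℕ p b

-- Local complementation and pivoting

⋆-≢ : (G : Graph n) (w : Fin n) {x y : Fin n} → x ≢ y → (G ⋆ w) x y ≡ G x y xor (G w x ∧ G w y)
⋆-≢ G w {x} {y} x≢y with x ≟ᶠ y
... | yes x≡y = contradiction x≡y x≢y
... | no  _   = refl

⋆-refl : (G : Graph n) (w x : Fin n) → (G ⋆ w) x x ≡ G x x
⋆-refl G w x with x ≟ᶠ x
... | yes _   = refl
... | no  x≢x = contradiction refl x≢x

pivot-refl : (G : Graph n) (u v x : Fin n) → pivot G u v x x ≡ G x x
pivot-refl G u v x = trans (⋆-refl ((G ⋆ u) ⋆ v) u x) (trans (⋆-refl (G ⋆ u) v x) (⋆-refl G u x))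

pivot-≢ : (G : Graph n) {u v x y : Fin n} → u ≢ v → x ≢ y → x ≢ u → x ≢ v → y ≢ u → y ≢ v →
  G u u ≡ false → G u v ≡ true → G v u ≡ true →
  pivot G u v x y ≡ G x y xor ((G u x ∧ G v y) xor (G v x ∧ G u y))
pivot-≢ G {u} {v} {x} {y} u≢v x≢y x≢u x≢v y≢u y≢v Guu Guv Gvu
  rewrite ⋆-≢ ((G ⋆ u) ⋆ v) u x≢y
        | ⋆-≢ (G ⋆ u) v (x≢u ∘ sym) | ⋆-≢ (G ⋆ u) v (y≢u ∘ sym) | ⋆-≢ (G ⋆ u) v x≢y
        | ⋆-≢ G u (x≢v ∘ sym) | ⋆-≢ G u (y≢v ∘ sym) | ⋆-≢ G u x≢y | ⋆-≢ G u (u≢v ∘ sym)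
        | ⋆-≢ G u (x≢u ∘ sym) | ⋆-≢ G u (y≢u ∘ sym) | Guu | Guv | Gvu
  = identity (G x y) (G u x) (G u y) (G v x) (G v y)
  where
  identity : ∀ xy ux uy vx vy →
    ((xy xor (ux ∧ uy)) xor ((vx xor ux) ∧ (vy xor uy))) xor
      (((ux xor false) xor ((true xor false) ∧ (vx xor ux))) ∧ ((uy xor false) xor ((true xor false) ∧ (vy xor uy))))
    ≡ xy xor ((ux ∧ vy) xor (vx ∧ uy))
  identity = solve-∀ GF₂

flip-≢ : (G : Graph n) (X : Fin n → Bool) {x y : Fin n} → x ≢ y → flip G X x y ≡ G x y xor (X x ∧ X y)
flip-≢ G X {x} {y} x≢y with x ≟ᶠ y
... | yes x≡y = contradiction x≡y x≢y
... | no  _ with X x ∧ X y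
...   | true  = sym (xor-true _)
...   | false = sym (xor-identityʳ _)

flip-refl : (G : Graph n) (X : Fin n → Bool) (x : Fin n) → flip G X x x ≡ G x x
flip-refl G X x with x ≟ᶠ x
... | yes _   rewrite ∧-zeroʳ (X x ∧ X x) = refl
... | no  x≢x = contradiction refl x≢x

-- Pivot-minors

restrict : Graph n → (Fin m → Fin n) → Graph m
restrict G e i j = G (e i) (e j)

HasPivotMinor : Graph n → Graph m → Set
HasPivotMinor G K = ∃ λ k → Σ (Graph k) λ H → PivotMinor G H × (H ≅ K)

HasPivotMinor-resp-≗ : {G : Graph n} {K K′ : Graph m} →
  HasPivotMinor G K → (∀ i j → K i j ≡ K′ i j) → HasPivotMinor G K′
HasPivotMinor-resp-≗ (k , H , G⇝H , f , H≅K) K≗K′ = k , H , G⇝H , f , λ x y → trans (H≅K x y) (K≗K′ _ _)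

bijection-restrict-≅ : (G : Graph n) (e : Fin m → Fin n) → Injective _≡_ _≡_ e →
  (∀ v → ∃ λ i → e i ≡ v) → G ≅ restrict G e
bijection-restrict-≅ {n} {m} G e e-injective e-surjective =
  mk⤖ {to = e⁻¹} (e⁻¹-injective , e⁻¹-surjective) , λ x y → sym (cong₂ G (e∘e⁻¹ x) (e∘e⁻¹ y))
  where
  e⁻¹ : Fin n → Fin m
  e⁻¹ v = proj₁ (e-surjective v)
  e∘e⁻¹ : ∀ v → e (e⁻¹ v) ≡ v
  e∘e⁻¹ v = proj₂ (e-surjective v)
  e⁻¹-injective : Injective _≡_ _≡_ e⁻¹
  e⁻¹-injective {x} {y} eq = trans (sym (e∘e⁻¹ x)) (trans (cong e eq) (e∘e⁻¹ y))
  e⁻¹-surjective : ∀ i → ∃ λ v → ∀ {w} → w ≡ v → e⁻¹ w ≡ i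
  e⁻¹-surjective i = e i , λ { refl → e-injective (e∘e⁻¹ (e i)) }

induced-hasPivotMinor : ∀ n (G : Graph n) (e : Fin m → Fin n) → Injective _≡_ _≡_ e →
  HasPivotMinor G (restrict G e)
induced-hasPivotMinor n G e e-injective with all? (λ v → any? (λ i → e i ≟ᶠ v))
... | yes e-surjective = n , G , pm-refl G , bijection-restrict-≅ G e e-injective e-surjective
induced-hasPivotMinor zero    G e e-injective | no ¬e-surjective = contradiction (λ ()) ¬e-surjective
induced-hasPivotMinor {m} (suc n) G e e-injective | no ¬e-surjective
  with ¬∀⟶∃¬ (suc n) _ (λ v → any? (λ i → e i ≟ᶠ v)) ¬e-surjective
... | v , v∉e = deleting (induced-hasPivotMinor n (delete G v) e′ e′-injective)
  where
  v≢e : ∀ i → v ≢ e i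
  v≢e i eq = v∉e (i , sym eq)
  e′ : Fin m → Fin n
  e′ i = punchOut (v≢e i)
  e′-injective : Injective _≡_ _≡_ e′
  e′-injective eq = e-injective (punchOut-injective (v≢e _) (v≢e _) eq)
  deleting : HasPivotMinor (delete G v) (restrict (delete G v) e′) → HasPivotMinor G (restrict G e)
  deleting (k , H , G-v⇝H , H≅) =
    HasPivotMinor-resp-≗ (k , H , pm-del v G-v⇝H , H≅)
      λ i j → cong₂ G (punchIn-punchOut (v≢e i)) (punchIn-punchOut (v≢e j))

-- Flipped paths

record InducedFlippedPath (G : Graph n) (L : ℕ) (X : ℕ → Bool) : Set where
  field
    vertex    : ℕ → Fin n
    injective : ∀ {a b} → a < L → b < L → vertex a ≡ vertex b → a ≡ b
    loopless  : ∀ {a} → a < L → G (vertex a) (vertex a) ≡ false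
    adjacent  : ∀ {a b} → a < L → b < L → a ≢ b →
                G (vertex a) (vertex b) ≡ adjℕ a b xor (X a ∧ X b)

  vertex-≢ : ∀ {a b} → a < L → b < L → a ≢ b → vertex a ≢ vertex b
  vertex-≢ a<L b<L a≢b = a≢b ∘ injective a<L b<L

flippedPath-induced : ∀ n (X : Fin (suc n) → Bool) →
  InducedFlippedPath (flip (Path (suc n)) X) (suc n) (X ∘ (_mod suc n))
flippedPath-induced n X = record
  { vertex    = _mod suc n
  ; injective = mod-injective
  ; loopless  = λ {a} a<L → trans (flip-refl (Path (suc n)) X _) (trans (path a<L a<L) (adjℕ-irrefl a))
  ; adjacent  = λ {a} {b} a<L b<L a≢b →
      trans (flip-≢ (Path (suc n)) X (a≢b ∘ mod-injective a<L b<L))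
            (cong (_xor (X (a mod suc n) ∧ X (b mod suc n))) (path a<L b<L))
  }
  where
  toℕ-mod : ∀ {a} → a < suc n → toℕ (a mod suc n) ≡ a
  toℕ-mod a<L = trans (toℕ-fromℕ< _) (m<n⇒m%n≡m a<L)
  mod-injective : ∀ {a b} → a < suc n → b < suc n → a mod suc n ≡ b mod suc n → a ≡ b
  mod-injective a<L b<L eq = trans (sym (toℕ-mod a<L)) (trans (cong toℕ eq) (toℕ-mod b<L))
  path : ∀ {a b} → a < suc n → b < suc n → Path (suc n) (a mod suc n) (b mod suc n) ≡ adjℕ a b
  path a<L b<L = cong₂ adjℕ (toℕ-mod a<L) (toℕ-mod b<L)

SparseWindow : (ℕ → Bool) → ℕ → ℕ → Set
SparseWindow X w t = ∃ λ c → ∀ i → i < t → w + i ≢ c → X (w + i) ≡ false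

module _ {G : Graph n} {X : ℕ → Bool} (P : InducedFlippedPath G L X) where
  open InducedFlippedPath P

  sparseWindow-hasPivotMinor : ∀ {t} w → w + t ≤ L → SparseWindow X w t → HasPivotMinor G (Path t)
  sparseWindow-hasPivotMinor {t} w w+t≤L (c , sparse) =
    HasPivotMinor-resp-≗ (induced-hasPivotMinor _ G e e-injective) restrict≗Path
    where
    inWindow : (i : Fin t) → w + toℕ i < L
    inWindow i = ≤-trans (+-monoʳ-< w (toℕ<n i)) w+t≤L
    e : Fin t → Fin n
    e i = vertex (w + toℕ i)
    w+-injective : ∀ {i j : Fin t} → w + toℕ i ≡ w + toℕ j → i ≡ j
    w+-injective = toℕ-injective ∘ +-cancelˡ-≡ w _ _
    e-injective : Injective _≡_ _≡_ e
    e-injective {i} {j} = w+-injective ∘ injective (inWindow i) (inWindow j)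
    unflipped : ∀ {i j} → i ≢ j → X (w + toℕ i) ∧ X (w + toℕ j) ≡ false
    unflipped {i} {j} i≢j with w + toℕ i ≟ c
    ... | no  i≢c = cong (_∧ X (w + toℕ j)) (sparse _ (toℕ<n i) i≢c)
    ... | yes i≡c = trans (cong (X _ ∧_) (sparse _ (toℕ<n j) λ j≡c → i≢j (w+-injective (trans i≡c (sym j≡c)))))
                          (∧-zeroʳ _)
    restrict≗Path : ∀ i j → restrict G e i j ≡ Path t i j
    restrict≗Path i j with i ≟ᶠ j
    ... | yes refl = trans (loopless (inWindow i)) (sym (adjℕ-irrefl (toℕ i)))
    ... | no  i≢j  = begin
      G (e i) (e j)
        ≡⟨ adjacent (inWindow i) (inWindow j) (i≢j ∘ w+-injective) ⟩
      adjℕ (w + toℕ i) (w + toℕ j) xor (X (w + toℕ i) ∧ X (w + toℕ j))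
        ≡⟨ cong₂ _xor_ (adjℕ-+ w (toℕ i) (toℕ j)) (unflipped i≢j) ⟩
      adjℕ (toℕ i) (toℕ j) xor false
        ≡⟨ xor-identityʳ _ ⟩
      Path t i j ∎
      where open ≡-Reasoning

-- The flip set left after pivoting the flipped pair p, q, renumbered along punchIn₂ p q.
removePair : ℕ → ℕ → (ℕ → Bool) → ℕ → Bool
removePair p q X a = let A = punchIn₂ p q a in X A xor (adjℕ p A xor adjℕ q A)

module _ {p q} (p+2≤q : 2 + p ≤ q) (X : ℕ → Bool) where

  removePair-< : ∀ {a} → suc a < p → removePair p q X a ≡ X a
  removePair-< {a} a+1<p
    rewrite punchIn₂-< p+2≤q (<-trans (n<1+n a) a+1<p)
          | adjℕ-far-sym a+1<p
          | adjℕ-far-sym {a} {q} (<-trans a+1<p (<-trans (n<1+n p) p+2≤q))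
    = xor-identityʳ (X a)

  removePair-pred : ∀ {a} → suc a ≡ p → removePair p q X a ≡ not (X a)
  removePair-pred {a} refl
    rewrite punchIn₂-< p+2≤q (n<1+n a)
          | adjℕ-sym (suc a) a | adjℕ-suc a
          | adjℕ-far-sym {a} {q} (<-trans (n<1+n _) p+2≤q)
    = xor-true (X a)

module PivotPair {G : Graph n} {X : ℕ → Bool} (P : InducedFlippedPath G (2 + L) X)
                 {p q} (p+2≤q : 2 + p ≤ q) (q<2+L : q < 2 + L) (Xp : X p ≡ true) (Xq : X q ≡ true) where
  open InducedFlippedPath P

  private
    p<2+L : p < 2 + L
    p<2+L = <-trans (≤-trans (n≤1+n _) p+2≤q) q<2+L
    p≢q : p ≢ q
    p≢q = <⇒≢ (≤-trans (n≤1+n _) p+2≤q)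
    ι : ℕ → ℕ
    ι = punchIn₂ p q

  u v : Fin n
  u = vertex p
  v = vertex q

  private
    adjacentˡ : ∀ {a r} → a < 2 + L → r < 2 + L → a ≢ r → X r ≡ true →
                G (vertex r) (vertex a) ≡ adjℕ r a xor X a
    adjacentˡ {a} {r} a<L r<L a≢r Xr = trans (adjacent r<L a<L (a≢r ∘ sym)) (cong (λ x → adjℕ r a xor (x ∧ X a)) Xr)

  edge : G u v ≡ true
  edge = trans (adjacentˡ q<2+L p<2+L (p≢q ∘ sym) Xp) (cong₂ _xor_ (adjℕ-far p+2≤q) Xq)

  edge-sym : G v u ≡ true
  edge-sym = trans (adjacentˡ p<2+L q<2+L p≢q Xq) (cong₂ _xor_ (adjℕ-far-sym p+2≤q) Xp)

  pivoted : InducedFlippedPath (pivot G u v) L (removePair p q X)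
  pivoted = record
    { vertex    = vertex ∘ ι
    ; injective = λ a<L b<L → punchIn₂-injective p+2≤q ∘ injective (bound a<L) (bound b<L)
    ; loopless  = λ a<L → trans (pivot-refl G u v _) (loopless (bound a<L))
    ; adjacent  = adjacent′
    }
    where
    bound : ∀ {a} → a < L → ι a < 2 + L
    bound = punchIn₂-bound p+2≤q
    adjacent′ : ∀ {a b} → a < L → b < L → a ≢ b →
      pivot G u v (vertex (ι a)) (vertex (ι b)) ≡ adjℕ a b xor (removePair p q X a ∧ removePair p q X b)
    adjacent′ {a} {b} a<L b<L a≢b = begin
      pivot G u v x y
        ≡⟨ pivot-≢ G (vertex-≢ p<2+L q<2+L p≢q) (vertex-≢ A<L B<L A≢B)
                     (vertex-≢ A<L p<2+L A≢p) (vertex-≢ A<L q<2+L A≢q)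
                     (vertex-≢ B<L p<2+L B≢p) (vertex-≢ B<L q<2+L B≢q)
                     (loopless p<2+L) edge edge-sym ⟩
      G x y xor ((G u x ∧ G v y) xor (G v x ∧ G u y))
        ≡⟨ cong₂ _xor_ (adjacent A<L B<L A≢B)
             (cong₂ _xor_ (cong₂ _∧_ (adjacentˡ A<L p<2+L A≢p Xp) (adjacentˡ B<L q<2+L B≢q Xq))
                          (cong₂ _∧_ (adjacentˡ A<L q<2+L A≢q Xq) (adjacentˡ B<L p<2+L B≢p Xp))) ⟩
      (adjℕ A B xor (X A ∧ X B)) xor
        (((adjℕ p A xor X A) ∧ (adjℕ q B xor X B)) xor ((adjℕ q A xor X A) ∧ (adjℕ p B xor X B)))
        ≡⟨ identity (adjℕ A B) (adjℕ p A) (adjℕ q A) (adjℕ p B) (adjℕ q B) (X A) (X B) ⟩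
      ((adjℕ A B xor (adjℕ q A ∧ adjℕ q B)) xor (adjℕ p A ∧ adjℕ p B)) xor
        (removePair p q X a ∧ removePair p q X b)
        ≡⟨ cong (_xor (removePair p q X a ∧ removePair p q X b)) (adjℕ-punchIn₂ p+2≤q a≢b) ⟨
      adjℕ a b xor (removePair p q X a ∧ removePair p q X b) ∎
      where
      open ≡-Reasoning
      A = ι a
      B = ι b
      x = vertex A
      y = vertex B
      A<L = bound a<L
      B<L = bound b<L
      A≢B = a≢b ∘ punchIn₂-injective p+2≤q
      A≢p = punchIn₂-≢ˡ p+2≤q a
      A≢q = punchIn₂-≢ʳ p+2≤q a
      B≢p = punchIn₂-≢ˡ p+2≤q b
      B≢q = punchIn₂-≢ʳ p+2≤q b
      identity : ∀ ab pa qa pb qb xa xb →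
        (ab xor (xa ∧ xb)) xor (((pa xor xa) ∧ (qb xor xb)) xor ((qa xor xa) ∧ (pb xor xb)))
        ≡ ((ab xor (qa ∧ qb)) xor (pa ∧ pb)) xor ((xa xor (pa xor qa)) ∧ (xb xor (pb xor qb)))
      identity = solve-∀ GF₂

data Reducible (t : ℕ) : ℕ → (ℕ → Bool) → Set where
  sparse-window : ∀ {L X} w → w + t ≤ L → SparseWindow X w t → Reducible t L X
  pivot-pair    : ∀ {L X} p q → 2 + p ≤ q → q < 2 + L → X p ≡ true → X q ≡ true →
                  Reducible t L (removePair p q X) → Reducible t (2 + L) X

reducible⇒hasPivotMinor : ∀ {t} {G : Graph n} {X} → InducedFlippedPath G L X → Reducible t L X →
  HasPivotMinor G (Path t)
reducible⇒hasPivotMinor P (sparse-window w w+t≤L sparse) = sparseWindow-hasPivotMinor P w w+t≤L sparse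
reducible⇒hasPivotMinor P (pivot-pair p q p+2≤q q<2+L Xp Xq R) =
  let open PivotPair P p+2≤q q<2+L Xp Xq
      k , H , G∧uv⇝H , H≅Pₜ = reducible⇒hasPivotMinor pivoted R
  in  k , H , pm-pivot u v edge G∧uv⇝H , H≅Pₜ

-- Reducing flipped paths

first-true : (f : ℕ → Bool) (d : ℕ) →
  (∀ i → i < d → f i ≡ false) ⊎ ∃ λ i → i < d × f i ≡ true × (∀ j → j < i → f j ≡ false)
first-true f zero = inj₁ λ _ ()
first-true f (suc d) with first-true f d
... | inj₂ (i , i<d , fi , below) = inj₂ (i , m≤n⇒m≤1+n i<d , fi , below)
... | inj₁ none with f d in fd
...   | true  = inj₂ (d , ≤-refl , fd , none)
...   | false = inj₁ λ i i<1+d → case (m≤n⇒m<n∨m≡n (s≤s⁻¹ i<1+d))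
  where
  case : ∀ {i} → i < d ⊎ i ≡ d → f i ≡ false
  case (inj₁ i<d)  = none _ i<d
  case (inj₂ refl) = fd

Clear : (ℕ → Bool) → ℕ → Set
Clear X k = ∀ i → i < k → X i ≡ false

module Reduction (t : ℕ) where

  budget : ℕ → ℕ
  budget d = 2 * t * suc d

  t≤budget : ∀ d → t ≤ budget d
  t≤budget d = ≤-trans (m≤m+n t (t + 0)) (m≤m*n (2 * t) (suc d))

  budget-suc : ∀ d → budget (suc d) ≡ 2 * t + budget d
  budget-suc d = *-suc (2 * t) (suc d)

  pivot-pair′ : ∀ {L X} p q → 2 + p ≤ q → q < L → X p ≡ true → X q ≡ true →
                Reducible t (L ∸ 2) (removePair p q X) → Reducible t L X
  pivot-pair′ {suc (suc L)} = pivot-pair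
  pivot-pair′ {suc zero} p q (s≤s (s≤s _)) (s≤s ())

  pivot-or-window : ∀ {p L X} → 2 + p + t ≤ L → X p ≡ true →
    (∀ q → 2 + p ≤ q → Reducible t (L ∸ 2) (removePair p q X)) → Reducible t L X
  pivot-or-window {p} {X = X} fits Xp reduced with first-true (λ i → X (2 + p + i)) t
  ... | inj₁ none = sparse-window (2 + p) fits (0 , λ i i<t _ → none i i<t)
  ... | inj₂ (i , i<t , Xq , _) =
    pivot-pair′ p (2 + p + i) (m≤m+n _ i) (≤-trans (+-monoʳ-< (2 + p) i<t) fits) Xp Xq (reduced _ (m≤m+n _ i))

  window-fits : ∀ {k d m L} → k + suc d ≡ t → m < d → budget d + 2 * suc m ≤ L → 2 + (k + suc m) + t ≤ L
  window-fits {k} {d} {m} {L} k+1+d≡t m<d budget≤L = begin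
    2 + (k + suc m) + t  ≤⟨ +-monoˡ-≤ t (s≤s p<t) ⟩
    suc t + t            ≡⟨ cong (λ t′ → suc (t + t′)) (sym (+-identityʳ t)) ⟩
    suc (2 * t)          ≡⟨ +-comm 1 (2 * t) ⟩
    2 * t + 1            ≤⟨ +-mono-≤ (m≤m*n (2 * t) (suc d)) (s≤s z≤n) ⟩
    budget d + 2 * suc m ≤⟨ budget≤L ⟩
    L                    ∎
    where
    open ≤-Reasoning
    p<t : k + suc m < t
    p<t = subst (k + suc m <_) k+1+d≡t (+-monoʳ-< k (s≤s m<d))

  mutual
    reducible-clear : ∀ d {k L X} → k + d ≡ t → Clear X k → budget d ≤ L → Reducible t L X
    reducible-clear zero {k} k+0≡t clear budget≤L =
      sparse-window 0 (≤-trans (t≤budget 0) budget≤L)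
        (t , λ i i<t _ → clear i (subst (i <_) (trans (sym k+0≡t) (+-identityʳ k)) i<t))
    reducible-clear (suc d) {k} {L} {X} k+d≡t clear budget≤L with X k in Xk
    ... | false = reducible-clear d (trans (sym (+-suc k d)) k+d≡t) clear′ (≤-trans budget-mono budget≤L)
      where
      budget-mono : budget d ≤ budget (suc d)
      budget-mono = *-monoʳ-≤ (2 * t) (n≤1+n _)
      clear′ : Clear X (suc k)
      clear′ i i<1+k with m≤n⇒m<n∨m≡n (s≤s⁻¹ i<1+k)
      ... | inj₁ i<k  = clear i i<k
      ... | inj₂ refl = Xk
    ... | true with first-true (λ i → X (k + suc i)) d
    ...   | inj₁ none = sparse-window 0 (≤-trans (t≤budget (suc d)) budget≤L) (k , only-k)
      where
      only-k : ∀ i → i < t → i ≢ k → X i ≡ false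
      only-k i i<t i≢k with <-cmp i k
      ... | tri< i<k _ _ = clear i i<k
      ... | tri≈ _ i≡k _ = contradiction i≡k i≢k
      ... | tri> _ _ k<i =
        subst (λ j → X j ≡ false) k+1+j≡i
          (none j (s<s⁻¹ (+-cancelˡ-< k _ _ (subst₂ _<_ (sym k+1+j≡i) (sym k+d≡t) i<t))))
        where
        j = i ∸ suc k
        k+1+j≡i : k + suc j ≡ i
        k+1+j≡i = trans (+-suc k j) (m+[n∸m]≡n k<i)
    ...   | inj₂ (m , m<d , Xm , below) = reducible-chain m k+d≡t clear Xk Xm below m<d chain-budget
      where
      1+m≤t : suc m ≤ t
      1+m≤t = ≤-trans m<d (≤-trans (n≤1+n d) (subst (suc d ≤_) k+d≡t (m≤n+m (suc d) k)))
      chain-budget : budget d + 2 * suc m ≤ L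
      chain-budget = ≤-trans (+-monoʳ-≤ (budget d) (*-monoʳ-≤ 2 1+m≤t))
                             (subst (_≤ L) (trans (budget-suc d) (+-comm (2 * t) (budget d))) budget≤L)

    -- Pivoting k + m + 1 away flips k + m, so the gap behind k shrinks by one.
    reducible-chain : ∀ m {k d L X} → k + suc d ≡ t → Clear X k → X k ≡ true →
      X (k + suc m) ≡ true → (∀ i → i < m → X (k + suc i) ≡ false) → m < d →
      budget d + 2 * suc m ≤ L → Reducible t L X
    reducible-chain zero {k} {d} {X = X} k+1+d≡t clear Xk Xk+1 _ m<d budget≤L =
      pivot-or-window (window-fits k+1+d≡t m<d budget≤L) Xk+1 λ q p+2≤q →
        reducible-clear d (trans (sym (+-suc k d)) k+1+d≡t) (clear′ p+2≤q) (m+n≤o⇒m≤o∸n (budget d) budget≤L)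
      where
      clear′ : ∀ {q} → 2 + (k + 1) ≤ q → Clear (removePair (k + 1) q X) (suc k)
      clear′ p+2≤q i i<1+k with m≤n⇒m<n∨m≡n (s≤s⁻¹ i<1+k)
      ... | inj₁ i<k  = trans (removePair-< p+2≤q X (subst (suc i <_) (+-comm 1 k) (s≤s i<k))) (clear i i<k)
      ... | inj₂ refl = trans (removePair-pred p+2≤q X (+-comm 1 i)) (cong not Xk)
    reducible-chain (suc m) {k} {d} {L} {X} k+1+d≡t clear Xk Xp between m<d budget≤L =
      pivot-or-window (window-fits k+1+d≡t m<d budget≤L) Xp λ q p+2≤q →
        reducible-chain m k+1+d≡t
          (λ i i<k → trans (removePair-< p+2≤q X (before-p (≤-trans (<⇒≤ i<k) (m≤m+n k m)))) (clear i i<k))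
          (trans (removePair-< p+2≤q X (before-p (m≤m+n k m))) Xk)
          (trans (removePair-pred p+2≤q X (sym (+-suc k (suc m)))) (cong not (between m ≤-refl)))
          (λ i i<m → trans (removePair-< p+2≤q X (before-p (+-monoʳ-≤ k i<m))) (between i (m<n⇒m<1+n i<m)))
          (<-trans (n<1+n m) m<d)
          (m+n≤o⇒m≤o∸n (budget d + 2 * suc m) (subst (_≤ L) (budget-shift (budget d) m) budget≤L))
      where
      before-p : ∀ {a} → a ≤ k + m → suc a < k + suc (suc m)
      before-p {a} a≤k+m = subst (suc a <_) (sym (trans (+-suc k (suc m)) (cong suc (+-suc k m)))) (s≤s (s≤s a≤k+m))
      budget-shift : ∀ b m → b + 2 * suc (suc m) ≡ (b + 2 * suc m) + 2
      budget-shift = solve-ℕ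

budget-bound : ∀ s → let t = 2 + s in Reduction.budget t t ≤ 3 * (2 * t * t ∸ t ∸ 1)
budget-bound s = subst (Reduction.budget t t ≤_) (sym (trans (cong (3 *_) t²-count) surplus)) (m≤m+n _ _)
  where
  t = 2 + s
  c = 2 * s * s + 7 * s + 5
  t²-count : 2 * t * t ∸ t ∸ 1 ≡ c
  t²-count = begin
    2 * t * t ∸ t ∸ 1      ≡⟨ cong (λ x → x ∸ t ∸ 1) (square s) ⟩
    c + 1 + t ∸ t ∸ 1      ≡⟨ cong (_∸ 1) (m+n∸n≡m (c + 1) t) ⟩
    c + 1 ∸ 1              ≡⟨ m+n∸n≡m c 1 ⟩
    c                      ∎
    where
    open ≡-Reasoning
    square : ∀ s → 2 * (2 + s) * (2 + s) ≡ (2 * s * s + 7 * s + 5) + 1 + (2 + s)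
    square = solve-ℕ
  surplus : 3 * c ≡ Reduction.budget t t + (4 * s * s + 11 * s + 3)
  surplus = identity s
    where
    identity : ∀ s → 3 * (2 * s * s + 7 * s + 5) ≡ 2 * (2 + s) * suc (2 + s) + (4 * s * s + 11 * s + 3)
    identity = solve-ℕ

long-reducible : ∀ t {L} (X : ℕ → Bool) → 1 ≤ t → 1 ≤ L → 3 * (2 * t * t ∸ t ∸ 1) ≤ L → Reducible t L X
long-reducible (suc zero)    X _ 1≤L _ =
  sparse-window 0 1≤L (0 , λ { zero _ 0≢0 → contradiction refl 0≢0 ; (suc i) (s≤s ()) _ })
long-reducible (suc (suc s)) X _ _   bound =
  Reduction.reducible-clear (2 + s) (2 + s) {0} refl (λ _ ()) (≤-trans (budget-bound s) bound)

oneFlip⇒flip : {H G : Graph n} → OneFlip H G → ∃ λ X → G ≡ flip H X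
oneFlip⇒flip flip-none       = (λ _ → false) , refl
oneFlip⇒flip (flip-one X _)  = X , refl

proposition4p1 : (t n : ℕ) → 1 ≤ t → 1 ≤ n → 3 * (2 * t * t ∸ t ∸ 1) ≤ n →
    (G : Graph n) → OneFlip (Path n) G →
    Σ ℕ (λ m → Σ (Graph m) (λ H → PivotMinor G H × (H ≅ Path t)))
proposition4p1 t (suc n) 1≤t 1≤n bound G G-isOneFlip with oneFlip⇒flip G-isOneFlip
... | X , refl =
  reducible⇒hasPivotMinor (flippedPath-induced n X) (long-reducible t (X ∘ (_mod suc n)) 1≤t 1≤n bound)
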